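{- For any $M\in\Lambda^{\mathrm{rb}}$, at most one $\rightsquigarrow$-reduction sequence starts from $M$.
   Context: $\Lambda$ is the set of untyped $\lambda$-terms. A context $C[\ ]$ is a $\lambda$-term with exactly one hole $[\ ]$; $C[M]$ is the result of placing $M$ in the hole (variables may be captured). For every $\lambda$-term $M$ there is a new constant symbol $\underline{M}$, called an atom; atoms have no free variables and substitution leaves an atom unchanged. Terms may be built from variables, atoms, application and abstraction, with substitution and free variables extended accordingly. For $M\in\Lambda$, $M^\bullet$ is the result of replacing each free variable $x$ of $M$ in $M$ by $\underline{x}$; $\Lambda^\bullet=\{M^\bullet\mid M\in\Lambda\}$. Write $M\ \vec N$ for $M\ N_1\cdots N_n$ with $n\ge 0$. $\Lambda^{\mathrm{rb}}$ is the smallest set such that: $\underline{M}\in\Lambda^{\mathrm{rb}}$ for every $M\in\Lambda$; $\langle C[\ ], M\rangle \in \Lambda^{\mathrm{rb}}$ for every context $C[\ ]$ and $M\in\Lambda^\bullet$; $\langle C[\ ], M\ \vec N\rangle\in\Lambda^{\mathrm{rb}}$ for every context $C[\ ]$, $M\in\Lambda^{\mathrm{rb}}$ and $\vec N\in\Lambda^\bullet$ (formal application). The reduction $\rightsquigarrow$ on $\Lambda^{\mathrm{rb}}$ is the smallest relation with: (1) $\langle C[\ ], \underline{M}\rangle \rightsquigarrow \underline{C[M]}$ for $M\in\Lambda$; (2) $\langle C[\ ], \lambda x.M\rangle \rightsquigarrow \langle C[\lambda x.[\ ]], M[x:=\underline{x}]\rangle$ for $\lambda x.M\in\Lambda^\bullet$;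 (3) $\langle C[\ ], \underline{M}\ N_0\ \vec N\rangle \rightsquigarrow \langle C[\ ], \langle M\ [\ ], N_0\rangle\ \vec N\rangle$ for $M\in\Lambda$, $N_0,\vec N\in\Lambda^\bullet$; (4) $\langle C[\ ], (\lambda x.M)\ N_0\ \vec N\rangle\rightsquigarrow\langle C[\ ], M[x:=N_0]\ \vec N\rangle$ for $\lambda x.M, N_0,\vec N\in\Lambda^\bullet$; (5) if $M,M'\in\Lambda^{\mathrm{rb}}$, $M\rightsquigarrow M'$ and $\vec N\in\Lambda^\bullet$, then $\langle C[\ ], M\ \vec N\rangle\rightsquigarrow\langle C[\ ], M'\ \vec N\rangle$. -}

module Defs where

open import Data.Nat using (ℕ; _≟_)
open import Data.List using (List; []; _∷_; foldl; map)
open import Data.List.Relation.Unary.All using (All)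
open import Data.Product using (Σ; _×_; _,_)
open import Data.Unit using (⊤)
open import Relation.Nullary using (yes; no)
open import Relation.Binary.PropositionalEquality using (_≡_)

Var : Set
Var = ℕ

data Λ : Set where
  var : Var → Λ
  app : Λ → Λ → Λ
  lam : Var → Λ → Λ

data Ctx : Set where
  hole : Ctx
  appL : Ctx → Λ → Ctx
  appR : Λ → Ctx → Ctx
  lamC : Var → Ctx → Ctx

-- C[M]  (variables may be captured)
plug : Ctx → Λ → Λ
plug hole M = M
plug (appL C N) M = app (plug C M) N
plug (appR N C) M = app N (plug C M)
plug (lamC x C) M = lam x (plug C M)

plugC : Ctx → Ctx → Ctx
plugC hole D = D
plugC (appL C N) D = appL (plugC C D) N
plugC (appR N C) D = appR N (plugC C D)
plugC (lamC x C) D = lamC x (plugC C D)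

-- Generalised term syntax: variables, atoms M̲ (M ∈ Λ), application,
-- abstraction, and the pairs ⟨C[ ], M⟩ used to build Λ^rb.
data G : Set where
  var  : Var → G
  atom : Λ → G
  app  : G → G → G
  lam  : Var → G → G
  box  : Ctx → G → G

apps : G → List G → G
apps M Ns = foldl app M Ns

-- M[x := N]; atoms are left unchanged.  (Only used with closed N, so no
-- capture can occur.)
subst : Var → G → G → G
subst x N (var y) with x ≟ y
... | yes _ = N
... | no  _ = var y
subst x N (atom M) = atom M
subst x N (app M₁ M₂) = app (subst x N M₁) (subst x N M₂)
subst x N (lam y M) with x ≟ y
... | yes _ = lam y M
... | no  _ = lam y (subst x N M)
subst x N (box C M) = box C (subst x N M)

bulletUnder : List Var → Λ → G
bulletUnder bs (var x) = bv bs
  where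
  bv : List Var → G
  bv [] = atom (var x)
  bv (y ∷ ys) with x ≟ y
  ... | yes _ = var x
  ... | no  _ = bv ys
bulletUnder bs (app M N) = app (bulletUnder bs M) (bulletUnder bs N)
bulletUnder bs (lam x M) = lam x (bulletUnder (x ∷ bs) M)

-- M^• : replace each free variable x of M by the atom x̲
_• : Λ → G
M • = bulletUnder [] M

InΛ• : G → Set
InΛ• T = Σ Λ (λ M → (M •) ≡ T)

data InRB : G → Set where
  rb-atom : (M : Λ) → InRB (atom M)
  rb-box  : (C : Ctx) (M : G) → InΛ• M → InRB (box C M)
  rb-app  : (C : Ctx) (M : G) (Ns : List G) →
            InRB M → All InΛ• Ns → InRB (box C (apps M Ns))

infix 4 _⇝_
data _⇝_ : G → G → Set where
  r1 : (C : Ctx) (M : Λ) → box C (atom M) ⇝ atom (plug C M)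
  r2 : (C : Ctx) (x : Var) (M : G) → InΛ• (lam x M) →
       box C (lam x M) ⇝ box (plugC C (lamC x hole)) (subst x (atom (var x)) M)
  r3 : (C : Ctx) (M : Λ) (N₀ : G) (Ns : List G) → InΛ• N₀ → All InΛ• Ns →
       box C (apps (atom M) (N₀ ∷ Ns)) ⇝ box C (apps (box (appR M hole) N₀) Ns)
  r4 : (C : Ctx) (x : Var) (M N₀ : G) (Ns : List G) →
       InΛ• (lam x M) → InΛ• N₀ → All InΛ• Ns →
       box C (apps (lam x M) (N₀ ∷ Ns)) ⇝ box C (apps (subst x N₀ M) Ns)
  r5 : (C : Ctx) (M M′ : G) (Ns : List G) → InRB M → InRB M′ →
       M ⇝ M′ → All InΛ• Ns →
       box C (apps M Ns) ⇝ box C (apps M′ Ns)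

-- A finite reduction sequence M ⇝ M₁ ⇝ ⋯ ⇝ Mₙ starting from M,
-- given by the list [M₁, …, Mₙ].
RedSeq : G → List G → Set
RedSeq M [] = ⊤
RedSeq M (M′ ∷ ρ) = (M ⇝ M′) × RedSeq M′ ρ

-- Reduction is the graph of a partial function: the rule applicable to
-- ⟨C[ ], T⟩ is dictated by the head of the application spine of T (an atom,
-- an abstraction, or a nested pair, into which rule (5) descends), and the
-- reduct is computed from the head and the arguments alone. Two sequences of
-- equal length from the same term therefore agree step by step.
module Submission where

open import Defs
open import Data.List using (List; length; []; _∷_; _++_)
open import Data.List.Properties using (++-identityʳ)
open import Data.Maybe using (Maybe; just; nothing; map)
open import Data.Maybe.Properties using (just-injective)
open import Data.Product using (_,_)
open import Data.Nat.Properties using (suc-injective)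
open import Relation.Binary.PropositionalEquality
  using (_≡_; refl; sym; trans; cong; module ≡-Reasoning)

-- stepSpine C T Ns is the reduct of ⟨C[ ], T N₁ ⋯ Nₙ⟩; app nodes of T are
-- peeled off onto the argument list.
stepSpine : Ctx → G → List G → Maybe G
stepSpine C (app T N)  Ns        = stepSpine C T (N ∷ Ns)
stepSpine C (atom M)   []        = just (atom (plug C M))
stepSpine C (atom M)   (N₀ ∷ Ns) = just (box C (apps (box (appR M hole) N₀) Ns))
stepSpine C (lam x M)  []        = just (box (plugC C (lamC x hole)) (subst x (atom (var x)) M))
stepSpine C (lam x M)  (N₀ ∷ Ns) = just (box C (apps (subst x N₀ M) Ns))
stepSpine C (box D T)  Ns        = map (λ M′ → box C (apps M′ Ns)) (stepSpine D T [])
stepSpine C (var x)    Ns        = nothing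

step : G → Maybe G
step (box C T) = stepSpine C T []
step _         = nothing

stepSpine-apps : ∀ C T Ns Ms → stepSpine C (apps T Ns) Ms ≡ stepSpine C T (Ns ++ Ms)
stepSpine-apps C T []       Ms = refl
stepSpine-apps C T (N ∷ Ns) Ms = stepSpine-apps C (app T N) Ns Ms

step-box-apps : ∀ C T Ns → step (box C (apps T Ns)) ≡ stepSpine C T Ns
step-box-apps C T Ns = trans (stepSpine-apps C T Ns []) (cong (stepSpine C T) (++-identityʳ Ns))

step-box-apps-cong : ∀ C Ns {M M′} → step M ≡ just M′ →
                     step (box C (apps M Ns)) ≡ just (box C (apps M′ Ns))
step-box-apps-cong C Ns {box D T} {M′} eq = begin
  step (box C (apps (box D T) Ns))                  ≡⟨ step-box-apps C (box D T) Ns ⟩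
  map (λ N → box C (apps N Ns)) (stepSpine D T [])  ≡⟨ cong (map (λ N → box C (apps N Ns))) eq ⟩
  just (box C (apps M′ Ns))                         ∎
  where open ≡-Reasoning
step-box-apps-cong C Ns {var _}   ()
step-box-apps-cong C Ns {atom _}  ()
step-box-apps-cong C Ns {app _ _} ()
step-box-apps-cong C Ns {lam _ _} ()

⇝⇒step : ∀ {M M′} → M ⇝ M′ → step M ≡ just M′
⇝⇒step (r1 C M)                 = refl
⇝⇒step (r2 C x M _)             = refl
⇝⇒step (r3 C M N₀ Ns _ _)       = step-box-apps C (atom M) (N₀ ∷ Ns)
⇝⇒step (r4 C x M N₀ Ns _ _ _)   = step-box-apps C (lam x M) (N₀ ∷ Ns)
⇝⇒step (r5 C M M′ Ns _ _ s _)   = step-box-apps-cong C Ns (⇝⇒step s)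

⇝-deterministic : ∀ {M A B} → M ⇝ A → M ⇝ B → A ≡ B
⇝-deterministic s t = just-injective (trans (sym (⇝⇒step s)) (⇝⇒step t))

RedSeq-unique : (M : G) (ρ σ : List G) → RedSeq M ρ → RedSeq M σ →
                length ρ ≡ length σ → ρ ≡ σ
RedSeq-unique M []      []      _       _       _   = refl
RedSeq-unique M (A ∷ ρ) (B ∷ σ) (s , p) (t , q) len with ⇝-deterministic s t
... | refl = cong (A ∷_) (RedSeq-unique A ρ σ p q (suc-injective len))

proposition5 : (M : G) → InRB M → (ρ σ : List G) →
               RedSeq M ρ → RedSeq M σ → length ρ ≡ length σ → ρ ≡ σ
proposition5 M _ = RedSeq-unique M
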